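{- Let $p\ge 2$ be an integer. For $1\le q\le p-1$ and integers $0<j_1<j_2<\dots<j_q<p$, define $$n_q^{(p)}(j_1,\dots,j_q):=(-12)^q\, j_1\cdots j_q\,\frac{j_1(j_2-j_1)\cdots(j_q-j_{q-1})(p-j_q)}{\prod_{i=1}^{q}\left(p^3-p+j_i-j_i^3\right)}$$ and $$\begin{aligned}g_q^{(p)}(j_1,\dots,j_q):={}&-\tfrac{28}{9}p^2+\tfrac{49}{45}q+\tfrac{32}{9}j_1^2-\tfrac49-\tfrac49\,\frac{p^3-p}{j_1}+\tfrac{5}{18}(p^3-p)\left(\frac1{j_1}+\dots+\frac1{j_q}\right)\\&+\tfrac{38}{15}\left(j_1^2+\dots+j_q^2\right)+\frac{p^3-p}{5}\sum_{i=1}^{q}\frac{p+j_i}{p^2+j_i^2+pj_i-1}-\tfrac{13}{9}\left(j_1j_2+j_2j_3+\dots+j_{q-1}j_q+j_qp\right).\end{aligned}$$ Then $$\sum_{q=1}^{p-1}\ \sum_{0<j_1<\dots<j_q<p} n_q^{(p)}(j_1,\dots,j_q)\,g_q^{(p)}(j_1,\dots,j_q)=p(p+1)^2.$$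
   Context: For $q=1$, the product $j_1(j_2-j_1)\cdots(j_q-j_{q-1})(p-j_q)$ is $j_1(p-j_1)$ and the sum $j_1j_2+\dots+j_{q-1}j_q+j_qp$ is $j_1p$. -}

module Defs where

open import Data.Nat as ℕ using (ℕ; zero; suc)
open import Data.Integer using (+_)
open import Data.List using (List; []; _∷_; map; concatMap; upTo; length; foldr)
open import Data.Rational using (ℚ; 0ℚ; 1ℚ; _+_; _*_; _-_; -_; 1/_; _/_; ≢-nonZero)
open import Data.Rational.Properties using (_≟_)
open import Relation.Nullary using (yes; no)

ι : ℕ → ℚ
ι n = + n / 1

frac : (a b : ℕ) → .{{_ : ℕ.NonZero b}} → ℚ
frac a b = + a / b

-- multiplicative inverse; only ever applied to nonzero values below
-- (the value 0 for input 0 is an irrelevant convention)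
inv : ℚ → ℚ
inv x with x ≟ 0ℚ
... | yes _ = 0ℚ
... | no ne = 1/_ x {{≢-nonZero ne}}

sumℚ : List ℚ → ℚ
sumℚ = foldr _+_ 0ℚ

prodℚ : List ℚ → ℚ
prodℚ = foldr _*_ 1ℚ

between : ℕ → ℕ → List ℕ
between a b = map (a ℕ.+_) (upTo (b ℕ.∸ a))

-- incSeqs q lo p : all lists [j₁,…,j_q] with lo < j₁ < … < j_q < p
incSeqs : ℕ → ℕ → ℕ → List (List ℕ)
incSeqs zero    lo p = [] ∷ []
incSeqs (suc q) lo p = concatMap (λ j → map (j ∷_) (incSeqs q j p)) (between (suc lo) p)

cube : ℚ → ℚ
cube x = x * x * x

-- j₁(j₂-j₁)⋯(j_q-j_{q-1})(p-j_q), called with prev = 0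
gaps : ℕ → ℕ → List ℕ → ℚ
gaps p prev []       = ι p - ι prev
gaps p prev (j ∷ js) = (ι j - ι prev) * gaps p j js

adj : ℕ → List ℕ → ℚ
adj p []           = 0ℚ
adj p (j ∷ [])     = ι j * ι p
adj p (j ∷ k ∷ js) = ι j * ι k + adj p (k ∷ js)

-- first element (lists used here are nonempty)
head0 : List ℕ → ℕ
head0 []      = 0
head0 (j ∷ _) = j

powℚ : ℚ → ℕ → ℚ
powℚ x zero    = 1ℚ
powℚ x (suc n) = x * powℚ x n

nq : ℕ → List ℕ → ℚ
nq p js =
  powℚ (- ι 12) (length js) * prodℚ (map ι js) * gaps p 0 js
  * inv (prodℚ (map (λ j → cube (ι p) - ι p + ι j - cube (ι j)) js))

gq : ℕ → List ℕ → ℚ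
gq p js =
  - (frac 28 9 * (ι p * ι p))
  + frac 49 45 * ι (length js)
  + frac 32 9 * (ι j₁ * ι j₁)
  - frac 4 9
  - frac 4 9 * (P * inv (ι j₁))
  + frac 5 18 * P * sumℚ (map (λ j → inv (ι j)) js)
  + frac 38 15 * sumℚ (map (λ j → ι j * ι j) js)
  + (P * frac 1 5) * sumℚ (map (λ j → (ι p + ι j) * inv (ι p * ι p + ι j * ι j + ι p * ι j - 1ℚ)) js)
  - frac 13 9 * adj p js
  where
    j₁ = head0 js
    P  = cube (ι p) - ι p

totalSum : ℕ → ℚ
totalSum p = sumℚ (map (λ q → sumℚ (map (λ js → nq p js * gq p js) (incSeqs q 0 p))) (between 1 p))

{-# OPTIONS --safe #-}
module Submission where

-- Read 0 = j₀ < j₁ < ⋯ < j_q < p as a chain. Then n_q is the product of the edge weights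
-- w(a,b) = −12 b (b − a) / D(b), D(b) = p³ − p + b − b³, times the last gap p − j_q, and g_q is a term
-- depending on j₁ alone plus a sum of edge costs (−13/9 ab, including the last edge j_q → p) and of
-- vertex costs along the chain. Summing over all chains above a vertex l, the total weight B(l) and the
-- total weighted cost T(l) satisfy the first-step recurrences
--   B(l) = (p − l) + Σ_{l<j<p} w(l,j) B(j),
--   T(l) = (p − l) edge(l,p) + Σ_{l<j<p} w(l,j) (c(l,j) B(j) + T(j)),
-- where c(l,j) is the edge cost plus the vertex cost of j. With N = p (p − 1)², they are solved by
-- B(x) = x D(x) / 3N and T(x) = τ(x) / N for a polynomial τ.
-- Because D(j) = (p − j)(p² + pj + j² − 1), the denominators D(j), j and p² + pj + j² − 1 all cancel in
-- each summand w(l,j)(…), which leaves a polynomial in j; each recurrence then telescopes, through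
-- Faulhaber's power sums, to a polynomial identity in p and l. The double sum of the theorem equals
-- Σ_{0<j<p} w(0,j) h(j) B(j) + T(0), where h is the j₁-term of g_q, and is evaluated in the same way.

open import Algebra.Bundles using (CommutativeRing)
open import Algebra.Bundles.Raw using (RawRing)
import Data.Integer as ℤ
open import Data.List using (List; []; _∷_; map; concatMap; applyUpTo; length; _++_)
open import Data.List.Properties using (map-∘; map-applyUpTo)
open import Data.Maybe using (just; nothing)
open import Data.Nat as ℕ using (ℕ; zero; suc; z≤n; s≤s)
import Data.Nat.Coprimality as Coprime
import Data.Nat.Properties as ℕ
open import Data.Rational using (ℚ; mkℚ; toℚᵘ)
open import Function using (id; _∘_)
open import Level using (0ℓ)
open import Relation.Binary.PropositionalEquality
open import Relation.Nullary using (Dec; yes; no; contradiction)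

open import Defs

-- The polynomials of the proof are written once over an arbitrary raw ring with rational constants #_,
-- so that they can both be evaluated in ℚ and be handed to the ring solver as expressions.
module Polynomials (R : RawRing 0ℓ 0ℓ) (#_ : ℚ → RawRing.Carrier R) where
  open RawRing R using (Carrier; _+_; _*_; -_; 1#)

  private
    infixl 6 _-_
    infixr 8 _^_

    _-_ : Carrier → Carrier → Carrier
    x - y = x + - y

    _^_ : Carrier → ℕ → Carrier
    x ^ zero  = 1#
    x ^ suc n = x * x ^ n

  P : Carrier → Carrier
  P p = p * p * p - p

  -- D, Q and gFormula are written exactly as in Defs.nq and Defs.gq, so that they match by unfolding:
  -- gq p (j ∷ r) is gFormula with x = j, u = inv j, n = q and si, ss, sφ, a the four chain sums of g_q.
  -- In vertexCost and headCost, u and v likewise stand for 1/x and 1/Q p x.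
  D Q : Carrier → Carrier → Carrier
  D p x = P p + x - x * x * x
  Q p x = p * p + x * x + p * x - 1#

  N : Carrier → Carrier
  N p = p * (p - 1#) * (p - 1#)

  ω : Carrier → Carrier → Carrier
  ω l x = # ι 12 * x * (l - x)

  edgeCost : Carrier → Carrier → Carrier
  edgeCost l x = - (# frac 13 9 * (l * x))

  vertexCost : Carrier → Carrier → Carrier → Carrier → Carrier
  vertexCost p x u v =
    # frac 49 45 + # frac 38 15 * (x * x) + # frac 5 18 * P p * u + P p * # frac 1 5 * ((p + x) * v)

  headCost : Carrier → Carrier → Carrier → Carrier
  headCost p x u =
    - (# frac 28 9 * (p * p)) - # frac 4 9 + (# frac 32 9 * (x * x) - # frac 4 9 * (P p * u))

  gFormula : Carrier → Carrier → Carrier → Carrier → Carrier → Carrier → Carrier → Carrier → Carrier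
  gFormula p x u n si ss sφ a =
    - (# frac 28 9 * (p * p)) + # frac 49 45 * n + # frac 32 9 * (x * x) - # frac 4 9 - # frac 4 9 * (P p * u)
    + # frac 5 18 * P p * si + # frac 38 15 * ss + P p * # frac 1 5 * sφ - # frac 13 9 * a

  additivePart : Carrier → Carrier → Carrier → Carrier → Carrier → Carrier → Carrier
  additivePart p n si ss sφ a =
    # frac 49 45 * n + # frac 5 18 * P p * si + # frac 38 15 * ss + P p * # frac 1 5 * sφ - # frac 13 9 * a

  -- Faulhaber: Sₖ (1 + x) = Sₖ x + xᵏ.
  S₁ S₂ S₃ S₄ S₅ : Carrier → Carrier
  S₁ x = # frac 1 2 * x * (x - 1#)
  S₂ x = # frac 1 6 * x * (x - 1#) * (# ι 2 * x - 1#)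
  S₃ x = S₁ x ^ 2
  S₄ x = # frac 1 30 * x * (x - 1#) * (# ι 2 * x - 1#) * (# ι 3 * x ^ 2 - # ι 3 * x - 1#)
  S₅ x = # frac 1 12 * x ^ 2 * (x - 1#) ^ 2 * (# ι 2 * x ^ 2 - # ι 2 * x - 1#)

  σ₀ σ₁ : Carrier → Carrier
  σ₀ p = - (# frac 13 54 * P p)
  σ₁ p = p - # frac 5 27 * p ^ 2 + # frac 7 27

  σ₃ : Carrier
  σ₃ = # frac 25 27

  σ : Carrier → Carrier → Carrier
  σ p x = σ₀ p + σ₁ p * x + σ₃ * x ^ 3

  β : Carrier → Carrier
  β x = # frac 1 3 * x

  κ : Carrier → Carrier → Carrier → Carrier
  κ p l x = edgeCost l x * β x + σ p x

  η : Carrier → Carrier → Carrier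
  η p x = β x * (- (# frac 28 9 * (p * p)) - # frac 4 9 + # frac 32 9 * (x * x)) - # frac 4 27 * P p

  ν : Carrier → Carrier → Carrier
  ν p x = β x * D p x * (# frac 49 45 + # frac 38 15 * (x * x)) + # frac 5 54 * P p * D p x
        + # frac 1 15 * P p * x * (p + x) * (p - x)

  τ : Carrier → Carrier → Carrier
  τ p x = D p x * σ p x - ν p x

  F₁ F₂ : Carrier → Carrier → Carrier → Carrier
  F₁ p l x = # ι 4 * (l * S₂ x - S₃ x)
  F₂ p l x = # ι 12 * (l * (σ₀ p * S₁ x + σ₁ p * S₂ x + σ₃ * S₄ x)
                       - (σ₀ p * S₂ x + σ₁ p * S₃ x + σ₃ * S₅ x))
           - # frac 52 9 * l * (l * S₃ x - S₄ x)

  F₃ : Carrier → Carrier → Carrier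
  F₃ p x = # ι 4 * (# frac 28 9 * (p * p) + # frac 4 9) * S₃ x - # frac 128 9 * S₅ x
         + # frac 16 9 * P p * S₂ x

-- Opened only here: inside Polynomials, _+_, _*_ and -_ are the operations of the raw ring.
open import Data.Rational using (0ℚ; 1ℚ; _+_; _*_; _-_; -_; ≢-nonZero)
open import Data.Rational.Properties
  using ( +-*-commutativeRing; _≟_; ↥p/↧p≡p; p≡0⇒↥p≡0; toℚᵘ-injective; toℚᵘ-homo-+
        ; +-identityˡ; +-identityʳ; +-assoc; +-inverseʳ
        ; *-identityˡ; *-identityʳ; *-zeroˡ; *-zeroʳ; *-comm; *-assoc; *-distribˡ-+; *-inverseˡ )
import Data.Rational.Unnormalised as ℚᵘ
import Data.Rational.Unnormalised.Properties as ℚᵘ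
import Data.Integer.Tactic.RingSolver as ℤ-Solver
open import Tactic.RingSolver using (solve-∀)
open import Tactic.RingSolver.Core.AlmostCommutativeRing
  using (AlmostCommutativeRing; fromCommutativeRing)

ℚ-ring : AlmostCommutativeRing 0ℓ 0ℓ
ℚ-ring = fromCommutativeRing +-*-commutativeRing λ { (mkℚ (ℤ.+ 0) 0 _) → just refl ; _ → nothing }

open import Tactic.RingSolver.NonReflective ℚ-ring using (solve; _⊜_; Expr; Κ; _⊕_; _⊗_; ⊝_)

exprRawRing : ℕ → RawRing 0ℓ 0ℓ
exprRawRing n = record
  { Carrier = Expr ℚ n ; _≈_ = _≡_ ; _+_ = _⊕_ ; _*_ = _⊗_ ; -_ = ⊝_ ; 0# = Κ 0ℚ ; 1# = Κ 1ℚ }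

open Polynomials (CommutativeRing.rawRing +-*-commutativeRing) id
module ᴱ {n} = Polynomials (exprRawRing n) Κ

ι≡mkℚ : ∀ n → ι n ≡ mkℚ (ℤ.+ n) 0 (Coprime.sym (Coprime.1-coprimeTo n))
ι≡mkℚ n = ↥p/↧p≡p (mkℚ (ℤ.+ n) 0 _)

ι-suc : ∀ n → ι (suc n) ≡ 1ℚ + ι n
ι-suc n = toℚᵘ-injective (ℚᵘ.≃-trans numerators (ℚᵘ.≃-sym (toℚᵘ-homo-+ 1ℚ (ι n))))
  where
  identity : ∀ x → (ℤ.+ 1 ℤ.+ x) ℤ.* ℤ.+ 1 ≡ (ℤ.+ 1 ℤ.* ℤ.+ 1 ℤ.+ x ℤ.* ℤ.+ 1) ℤ.* ℤ.+ 1
  identity = ℤ-Solver.solve-∀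
  numerators : toℚᵘ (ι (suc n)) ℚᵘ.≃ toℚᵘ 1ℚ ℚᵘ.+ toℚᵘ (ι n)
  numerators rewrite ι≡mkℚ n | ι≡mkℚ (suc n) = ℚᵘ.*≡* (identity (ℤ.+ n))

ι-+ : ∀ m n → ι (m ℕ.+ n) ≡ ι m + ι n
ι-+ zero    n = sym (+-identityˡ (ι n))
ι-+ (suc m) n = begin
  ι (suc (m ℕ.+ n))  ≡⟨ ι-suc (m ℕ.+ n) ⟩
  1ℚ + ι (m ℕ.+ n)   ≡⟨ cong (1ℚ +_) (ι-+ m n) ⟩
  1ℚ + (ι m + ι n)   ≡⟨ sym (+-assoc 1ℚ (ι m) (ι n)) ⟩
  1ℚ + ι m + ι n     ≡⟨ cong (_+ ι n) (sym (ι-suc m)) ⟩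
  ι (suc m) + ι n    ∎
  where open ≡-Reasoning

ι-* : ∀ m n → ι (m ℕ.* n) ≡ ι m * ι n
ι-* zero    n = sym (*-zeroˡ (ι n))
ι-* (suc m) n = begin
  ι (n ℕ.+ m ℕ.* n)  ≡⟨ ι-+ n (m ℕ.* n) ⟩
  ι n + ι (m ℕ.* n)  ≡⟨ cong (ι n +_) (ι-* m n) ⟩
  ι n + ι m * ι n    ≡⟨ identity (ι n) (ι m) ⟩
  (1ℚ + ι m) * ι n   ≡⟨ cong (_* ι n) (sym (ι-suc m)) ⟩
  ι (suc m) * ι n    ∎
  where
  open ≡-Reasoning
  identity : ∀ x y → x + y * x ≡ (1ℚ + y) * x
  identity = solve-∀ ℚ-ring

ι-∸ : ∀ {m n} → n ℕ.≤ m → ι (m ℕ.∸ n) ≡ ι m - ι n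
ι-∸ {m} {n} n≤m = begin
  ι (m ℕ.∸ n)                 ≡⟨ identity (ι (m ℕ.∸ n)) (ι n) ⟩
  ι (m ℕ.∸ n) + ι n - ι n     ≡⟨ cong (_- ι n) (sym (ι-+ (m ℕ.∸ n) n)) ⟩
  ι (m ℕ.∸ n ℕ.+ n) - ι n     ≡⟨ cong (λ k → ι k - ι n) (ℕ.m∸n+n≡m n≤m) ⟩
  ι m - ι n                   ∎
  where
  open ≡-Reasoning
  identity : ∀ x y → x ≡ x + y - y
  identity = solve-∀ ℚ-ring

ι-p[p+1]² : ∀ p → ι (p ℕ.* (p ℕ.+ 1) ℕ.* (p ℕ.+ 1)) ≡ ι p * (ι p + 1ℚ) * (ι p + 1ℚ)
ι-p[p+1]² p = trans (ι-* (p ℕ.* (p ℕ.+ 1)) (p ℕ.+ 1))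
                    (cong₂ _*_ (trans (ι-* p (p ℕ.+ 1)) (cong (ι p *_) (ι-+ p 1))) (ι-+ p 1))

ι-nonzero : ∀ n → 0 ℕ.< n → ι n ≢ 0ℚ
ι-nonzero (suc n) _ ι≡0 with p≡0⇒↥p≡0 _ (trans (sym (ι≡mkℚ (suc n))) ι≡0)
... | ()

inv-cancelˡ : ∀ {x} → x ≢ 0ℚ → inv x * x ≡ 1ℚ
inv-cancelˡ {x} x≢0 with x ≟ 0ℚ
... | yes x≡0 = contradiction x≡0 x≢0
... | no  x≢0′ = *-inverseˡ x {{≢-nonZero x≢0′}}

inv-cancelʳ : ∀ {x} → x ≢ 0ℚ → x * inv x ≡ 1ℚ
inv-cancelʳ {x} x≢0 = trans (*-comm x (inv x)) (inv-cancelˡ x≢0)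

*-≢0 : ∀ {x y} → x ≢ 0ℚ → y ≢ 0ℚ → x * y ≢ 0ℚ
*-≢0 {x} {y} x≢0 y≢0 xy≡0 = y≢0 (begin
  y                 ≡⟨ sym (*-identityˡ y) ⟩
  1ℚ * y            ≡⟨ cong (_* y) (sym (inv-cancelˡ x≢0)) ⟩
  inv x * x * y     ≡⟨ *-assoc (inv x) x y ⟩
  inv x * (x * y)   ≡⟨ cong (inv x *_) xy≡0 ⟩
  inv x * 0ℚ        ≡⟨ *-zeroʳ (inv x) ⟩
  0ℚ                ∎)
  where open ≡-Reasoning

inv-* : ∀ x y → inv (x * y) ≡ inv x * inv y
inv-* x y = cases (x ≟ 0ℚ) (y ≟ 0ℚ)
  where
  open ≡-Reasoning
  identity : ∀ a b c u v → a * (b * u * (c * v)) ≡ a * (u * v) * (b * c)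
  identity = solve-∀ ℚ-ring
  cases : Dec (x ≡ 0ℚ) → Dec (y ≡ 0ℚ) → inv (x * y) ≡ inv x * inv y
  cases (yes refl) _        = trans (cong inv (*-zeroˡ y)) (sym (*-zeroˡ (inv y)))
  cases (no _)     (yes refl) = trans (cong inv (*-zeroʳ x)) (sym (*-zeroʳ (inv x)))
  cases (no x≢0)   (no y≢0) = begin
    inv (x * y)                                 ≡⟨ sym (*-identityʳ (inv (x * y))) ⟩
    inv (x * y) * 1ℚ                            ≡⟨ cong (inv (x * y) *_) (sym units) ⟩
    inv (x * y) * (inv x * x * (inv y * y))     ≡⟨ identity (inv (x * y)) (inv x) (inv y) x y ⟩
    inv (x * y) * (x * y) * (inv x * inv y)     ≡⟨ cong (_* (inv x * inv y)) (inv-cancelˡ (*-≢0 x≢0 y≢0)) ⟩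
    1ℚ * (inv x * inv y)                        ≡⟨ *-identityˡ (inv x * inv y) ⟩
    inv x * inv y                               ∎
    where
    units : inv x * x * (inv y * y) ≡ 1ℚ
    units = cong₂ _*_ (inv-cancelˡ x≢0) (inv-cancelˡ y≢0)

drop-unit : ∀ a b {u} → u ≡ 1ℚ → a + b * (u - 1ℚ) ≡ a
drop-unit a b refl = identity a b
  where
  identity : ∀ a b → a + b * (1ℚ - 1ℚ) ≡ a
  identity = solve-∀ ℚ-ring

sumFrom : ℕ → ℕ → (ℕ → ℚ) → ℚ
sumFrom a zero    f = 0ℚ
sumFrom a (suc n) f = f a + sumFrom (suc a) n f

sumBelow : ℕ → (ℕ → ℚ) → ℚ
sumBelow = sumFrom 0

sumBetween : ℕ → ℕ → (ℕ → ℚ) → ℚ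
sumBetween lo hi = sumFrom (suc lo) (hi ℕ.∸ suc lo)

infixl 10 sumBelow sumBetween
syntax sumBelow n (λ q → x) = ∑[ q < n ] x
syntax sumBetween lo hi (λ j → x) = ∑[ lo < j < hi ] x

sumFrom-cong : ∀ a n {f g : ℕ → ℚ} → (∀ j → a ℕ.≤ j → j ℕ.< a ℕ.+ n → f j ≡ g j) →
               sumFrom a n f ≡ sumFrom a n g
sumFrom-cong a zero    f≡g = refl
sumFrom-cong a (suc n) f≡g = cong₂ _+_
  (f≡g a ℕ.≤-refl (ℕ.m<m+n a (s≤s z≤n)))
  (sumFrom-cong (suc a) n (λ j a<j j<a+n → f≡g j (ℕ.<⇒≤ a<j) (subst (j ℕ.<_) (sym (ℕ.+-suc a n)) j<a+n)))

sumFrom-+ : ∀ a n (f g : ℕ → ℚ) → sumFrom a n (λ j → f j + g j) ≡ sumFrom a n f + sumFrom a n g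
sumFrom-+ a zero    f g = refl
sumFrom-+ a (suc n) f g =
  trans (cong (f a + g a +_) (sumFrom-+ (suc a) n f g))
        (identity (f a) (g a) (sumFrom (suc a) n f) (sumFrom (suc a) n g))
  where
  identity : ∀ x y s t → x + y + (s + t) ≡ x + s + (y + t)
  identity = solve-∀ ℚ-ring

sumFrom-*ˡ : ∀ a n c (f : ℕ → ℚ) → sumFrom a n (λ j → c * f j) ≡ c * sumFrom a n f
sumFrom-*ˡ a zero    c f = sym (*-zeroʳ c)
sumFrom-*ˡ a (suc n) c f =
  trans (cong (c * f a +_) (sumFrom-*ˡ (suc a) n c f)) (sym (*-distribˡ-+ c (f a) (sumFrom (suc a) n f)))

sumFrom-suc : ∀ a n (f : ℕ → ℚ) → sumFrom (suc a) n f ≡ sumFrom a n (f ∘ suc)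
sumFrom-suc a zero    f = refl
sumFrom-suc a (suc n) f = cong (f (suc a) +_) (sumFrom-suc (suc a) n f)

sumFrom-comm : ∀ a n b m (F : ℕ → ℕ → ℚ) →
               sumFrom a n (λ x → sumFrom b m (F x)) ≡ sumFrom b m (λ y → sumFrom a n (λ x → F x y))
sumFrom-comm a zero    b m F = sym (sumFrom-zero b m)
  where
  sumFrom-zero : ∀ b m → sumFrom b m (λ _ → 0ℚ) ≡ 0ℚ
  sumFrom-zero b zero    = refl
  sumFrom-zero b (suc m) = trans (+-identityˡ _) (sumFrom-zero (suc b) m)
sumFrom-comm a (suc n) b m F = trans (cong (sumFrom b m (F a) +_) (sumFrom-comm (suc a) n b m F))
                                     (sym (sumFrom-+ b m (F a) _))

sumFrom-telescope : ∀ {F f : ℚ → ℚ} → (∀ x → F (1ℚ + x) ≡ F x + f x) →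
                    ∀ a n → sumFrom a n (λ j → f (ι j)) ≡ F (ι (a ℕ.+ n)) - F (ι a)
sumFrom-telescope {F} step a zero = begin
  0ℚ                         ≡⟨ sym (+-inverseʳ (F (ι a))) ⟩
  F (ι a) - F (ι a)          ≡⟨ cong (λ k → F (ι k) - F (ι a)) (sym (ℕ.+-identityʳ a)) ⟩
  F (ι (a ℕ.+ 0)) - F (ι a)  ∎
  where open ≡-Reasoning
sumFrom-telescope {F} {f} step a (suc n) = begin
  f (ι a) + sumFrom (suc a) n (λ j → f (ι j))
    ≡⟨ cong (f (ι a) +_) (sumFrom-telescope {F} {f} step (suc a) n) ⟩
  f (ι a) + (F (ι (suc a ℕ.+ n)) - F (ι (suc a)))
    ≡⟨ cong₂ (λ k y → f (ι a) + (F (ι k) - y)) (sym (ℕ.+-suc a n))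
             (trans (cong F (ι-suc a)) (step (ι a))) ⟩
  f (ι a) + (F (ι (a ℕ.+ suc n)) - (F (ι a) + f (ι a)))
    ≡⟨ identity (f (ι a)) (F (ι (a ℕ.+ suc n))) (F (ι a)) ⟩
  F (ι (a ℕ.+ suc n)) - F (ι a)
    ∎
  where
  open ≡-Reasoning
  identity : ∀ y X z → y + (X - (z + y)) ≡ X - z
  identity = solve-∀ ℚ-ring

sumBetween-cong : ∀ {lo hi} {f g : ℕ → ℚ} → lo ℕ.< hi →
                  (∀ j → lo ℕ.< j → j ℕ.< hi → f j ≡ g j) →
                  ∑[ lo < j < hi ] f j ≡ ∑[ lo < j < hi ] g j
sumBetween-cong {lo} {hi} lo<hi f≡g = sumFrom-cong (suc lo) (hi ℕ.∸ suc lo)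
  (λ j lo<j j<hi → f≡g j lo<j (subst (j ℕ.<_) (ℕ.m+[n∸m]≡n lo<hi) j<hi))

sumBetween-cong-≗ : ∀ lo hi {f g : ℕ → ℚ} → f ≗ g → ∑[ lo < j < hi ] f j ≡ ∑[ lo < j < hi ] g j
sumBetween-cong-≗ lo hi f≗g = sumFrom-cong (suc lo) (hi ℕ.∸ suc lo) (λ j _ _ → f≗g j)

sumBetween-telescope : ∀ {F f : ℚ → ℚ} → (∀ x → F (1ℚ + x) ≡ F x + f x) →
                       ∀ {lo hi} → lo ℕ.< hi → ∑[ lo < j < hi ] f (ι j) ≡ F (ι hi) - F (1ℚ + ι lo)
sumBetween-telescope {F} {f} step {lo} {hi} lo<hi =
  trans (sumFrom-telescope {F} {f} step (suc lo) (hi ℕ.∸ suc lo))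
        (cong₂ (λ k y → F (ι k) - F y) (ℕ.m+[n∸m]≡n lo<hi) (ι-suc lo))

sum-cong : ∀ {X : Set} {f g : X → ℚ} → f ≗ g → ∀ xs → sumℚ (map f xs) ≡ sumℚ (map g xs)
sum-cong f≡g []       = refl
sum-cong f≡g (x ∷ xs) = cong₂ _+_ (f≡g x) (sum-cong f≡g xs)

sum-+ : ∀ {X : Set} (f g : X → ℚ) xs →
        sumℚ (map (λ x → f x + g x) xs) ≡ sumℚ (map f xs) + sumℚ (map g xs)
sum-+ f g []       = sym (+-identityˡ 0ℚ)
sum-+ f g (x ∷ xs) = trans (cong (f x + g x +_) (sum-+ f g xs)) (identity (f x) (g x) _ _)
  where
  identity : ∀ x y s t → x + y + (s + t) ≡ x + s + (y + t)
  identity = solve-∀ ℚ-ring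

sum-*ˡ : ∀ {X : Set} c (f : X → ℚ) xs → sumℚ (map (λ x → c * f x) xs) ≡ c * sumℚ (map f xs)
sum-*ˡ c f []       = sym (*-zeroʳ c)
sum-*ˡ c f (x ∷ xs) = trans (cong (c * f x +_) (sum-*ˡ c f xs)) (sym (*-distribˡ-+ c (f x) _))

sum-++ : ∀ {X : Set} (f : X → ℚ) xs ys →
         sumℚ (map f (xs ++ ys)) ≡ sumℚ (map f xs) + sumℚ (map f ys)
sum-++ f []       ys = sym (+-identityˡ _)
sum-++ f (x ∷ xs) ys = trans (cong (f x +_) (sum-++ f xs ys)) (sym (+-assoc (f x) _ _))

sum-concatMap : ∀ {X Y : Set} (f : Y → ℚ) (g : X → List Y) xs →
                sumℚ (map f (concatMap g xs)) ≡ sumℚ (map (λ x → sumℚ (map f (g x))) xs)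
sum-concatMap f g []       = refl
sum-concatMap f g (x ∷ xs) =
  trans (sum-++ f (g x) (concatMap g xs)) (cong (sumℚ (map f (g x)) +_) (sum-concatMap f g xs))

sum-applyUpTo : ∀ (f : ℕ → ℚ) a n (h : ℕ → ℕ) → (∀ i → h i ≡ a ℕ.+ i) →
                sumℚ (map f (applyUpTo h n)) ≡ sumFrom a n f
sum-applyUpTo f a zero    h h≡a+ = refl
sum-applyUpTo f a (suc n) h h≡a+ = cong₂ _+_
  (cong f (trans (h≡a+ 0) (ℕ.+-identityʳ a)))
  (sum-applyUpTo f (suc a) n (h ∘ suc) (λ i → trans (h≡a+ (suc i)) (ℕ.+-suc a i)))

sum-between : ∀ (f : ℕ → ℚ) a b → sumℚ (map f (between a b)) ≡ sumFrom a (b ℕ.∸ a) f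
sum-between f a b = trans (cong (sumℚ ∘ map f) (map-applyUpTo id (a ℕ.+_) (b ℕ.∸ a)))
                          (sum-applyUpTo f a (b ℕ.∸ a) (a ℕ.+_) (λ _ → refl))

sum-incSeqs-suc : ∀ (F : List ℕ → ℚ) q lo p →
  sumℚ (map F (incSeqs (suc q) lo p)) ≡ ∑[ lo < j < p ] sumℚ (map (F ∘ (j ∷_)) (incSeqs q j p))
sum-incSeqs-suc F q lo p = begin
  sumℚ (map F (incSeqs (suc q) lo p))
    ≡⟨ sum-concatMap F (λ j → map (j ∷_) (incSeqs q j p)) (between (suc lo) p) ⟩
  sumℚ (map (λ j → sumℚ (map F (map (j ∷_) (incSeqs q j p)))) (between (suc lo) p))
    ≡⟨ sum-cong (λ j → cong sumℚ (sym (map-∘ (incSeqs q j p)))) (between (suc lo) p) ⟩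
  sumℚ (map (λ j → sumℚ (map (F ∘ (j ∷_)) (incSeqs q j p))) (between (suc lo) p))
    ≡⟨ sum-between _ (suc lo) p ⟩
  ∑[ lo < j < p ] sumℚ (map (F ∘ (j ∷_)) (incSeqs q j p))
    ∎
  where open ≡-Reasoning

module Chains (p : ℕ) (w : ℕ → ℕ → ℚ) (t : ℕ → ℚ) (c : ℕ → ℕ → ℚ) (d : ℕ → ℚ) where

  weight cost : ℕ → List ℕ → ℚ
  weight lo []       = t lo
  weight lo (j ∷ js) = w lo j * weight j js
  cost lo []       = d lo
  cost lo (j ∷ js) = c lo j + cost j js

  W C : ℕ → ℕ → ℚ
  W q lo = sumℚ (map (weight lo) (incSeqs q lo p))
  C q lo = sumℚ (map (λ js → weight lo js * cost lo js) (incSeqs q lo p))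

  W< C< : ℕ → ℕ → ℚ
  W< n lo = ∑[ q < n ] W q lo
  C< n lo = ∑[ q < n ] C q lo

  W-suc : ∀ q lo → W (suc q) lo ≡ ∑[ lo < j < p ] (w lo j * W q j)
  W-suc q lo = trans (sum-incSeqs-suc (weight lo) q lo p)
                     (sumBetween-cong-≗ lo p (λ j → sum-*ˡ (w lo j) (weight j) (incSeqs q j p)))

  first-step : ∀ q lo (a : ℕ → ℚ) (F : List ℕ → ℚ) →
               (∀ j r → F (j ∷ r) ≡ w lo j * weight j r * (a j + cost j r)) →
               sumℚ (map F (incSeqs (suc q) lo p)) ≡ ∑[ lo < j < p ] (w lo j * (a j * W q j + C q j))
  first-step q lo a F F-cons = trans (sum-incSeqs-suc F q lo p) (sumBetween-cong-≗ lo p factor)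
    where
    identity : ∀ k x y z → k * x * (y + z) ≡ k * (y * x + x * z)
    identity = solve-∀ ℚ-ring
    factor : ∀ j → sumℚ (map (F ∘ (j ∷_)) (incSeqs q j p)) ≡ w lo j * (a j * W q j + C q j)
    factor j = begin
      sumℚ (map (F ∘ (j ∷_)) (incSeqs q j p))
        ≡⟨ sum-cong (λ r → trans (F-cons j r) (identity (w lo j) (weight j r) (a j) (cost j r))) (incSeqs q j p) ⟩
      sumℚ (map (λ r → w lo j * (a j * weight j r + weight j r * cost j r)) (incSeqs q j p))
        ≡⟨ sum-*ˡ (w lo j) _ (incSeqs q j p) ⟩
      w lo j * sumℚ (map (λ r → a j * weight j r + weight j r * cost j r) (incSeqs q j p))
        ≡⟨ cong (w lo j *_) (trans (sum-+ _ _ (incSeqs q j p))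
                                   (cong (_+ C q j) (sum-*ˡ (a j) (weight j) (incSeqs q j p)))) ⟩
      w lo j * (a j * W q j + C q j)
        ∎
      where open ≡-Reasoning

  sum-lengths : ∀ n lo (G : ℕ → ℕ → ℚ) →
                ∑[ q < n ] ∑[ lo < j < p ] (w lo j * G q j) ≡ ∑[ lo < j < p ] (w lo j * ∑[ q < n ] G q j)
  sum-lengths n lo G = trans (sumFrom-comm 0 n (suc lo) (p ℕ.∸ suc lo) (λ q j → w lo j * G q j))
                             (sumBetween-cong-≗ lo p (λ j → sumFrom-*ˡ 0 n (w lo j) (λ q → G q j)))

  nonempty-chains : ∀ n lo (a : ℕ → ℚ) (F : List ℕ → ℚ) →
                    (∀ j r → F (j ∷ r) ≡ w lo j * weight j r * (a j + cost j r)) →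
                    ∑[ q < n ] sumℚ (map F (incSeqs (suc q) lo p))
                    ≡ ∑[ lo < j < p ] (w lo j * (a j * W< n j + C< n j))
  nonempty-chains n lo a F F-cons = begin
    ∑[ q < n ] sumℚ (map F (incSeqs (suc q) lo p))
      ≡⟨ sumFrom-cong 0 n (λ q _ _ → first-step q lo a F F-cons) ⟩
    ∑[ q < n ] ∑[ lo < j < p ] (w lo j * (a j * W q j + C q j))
      ≡⟨ sum-lengths n lo (λ q j → a j * W q j + C q j) ⟩
    ∑[ lo < j < p ] (w lo j * ∑[ q < n ] (a j * W q j + C q j))
      ≡⟨ sumBetween-cong-≗ lo p (λ j → cong (w lo j *_) (linear j)) ⟩
    ∑[ lo < j < p ] (w lo j * (a j * W< n j + C< n j))
      ∎
    where
    open ≡-Reasoning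
    linear : ∀ j → ∑[ q < n ] (a j * W q j + C q j) ≡ a j * W< n j + C< n j
    linear j = trans (sumFrom-+ 0 n _ _) (cong (_+ C< n j) (sumFrom-*ˡ 0 n (a j) (λ q → W q j)))

  W<-suc : ∀ n lo → W< (suc n) lo ≡ t lo + ∑[ lo < j < p ] (w lo j * W< n j)
  W<-suc n lo = cong₂ _+_ (+-identityʳ (t lo)) (begin
    sumFrom 1 n (λ q → W q lo)                    ≡⟨ sumFrom-suc 0 n (λ q → W q lo) ⟩
    ∑[ q < n ] W (suc q) lo                        ≡⟨ sumFrom-cong 0 n (λ q _ _ → W-suc q lo) ⟩
    ∑[ q < n ] ∑[ lo < j < p ] (w lo j * W q j)    ≡⟨ sum-lengths n lo W ⟩
    ∑[ lo < j < p ] (w lo j * W< n j)              ∎)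
    where open ≡-Reasoning

  C<-suc : ∀ n lo → C< (suc n) lo ≡ t lo * d lo + ∑[ lo < j < p ] (w lo j * (c lo j * W< n j + C< n j))
  C<-suc n lo = cong₂ _+_ (+-identityʳ (t lo * d lo))
    (trans (sumFrom-suc 0 n (λ q → C q lo))
           (nonempty-chains n lo (c lo) (λ js → weight lo js * cost lo js) (λ _ _ → refl)))

  module _ (B T : ℕ → ℚ)
           (B-rec : ∀ lo → lo ℕ.< p → B lo ≡ t lo + ∑[ lo < j < p ] (w lo j * B j))
           (T-rec : ∀ lo → lo ℕ.< p → T lo ≡ t lo * d lo + ∑[ lo < j < p ] (w lo j * (c lo j * B j + T j)))
           where

    private
      longer : ∀ {n lo j} → p ℕ.≤ suc n ℕ.+ lo → lo ℕ.< j → p ℕ.≤ n ℕ.+ j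
      longer {n} {lo} {j} p≤ lo<j =
        ℕ.≤-trans p≤ (subst (ℕ._≤ n ℕ.+ j) (ℕ.+-suc n lo) (ℕ.+-monoʳ-≤ n lo<j))

    -- A chain above lo has fewer than p − lo vertices, so W< n lo and C< n lo are complete once p ≤ n + lo.
    W<-solution : ∀ n lo → lo ℕ.< p → p ℕ.≤ n ℕ.+ lo → W< n lo ≡ B lo
    W<-solution zero    lo lo<p p≤lo = contradiction p≤lo (ℕ.<⇒≱ lo<p)
    W<-solution (suc n) lo lo<p p≤ = begin
      W< (suc n) lo                                ≡⟨ W<-suc n lo ⟩
      t lo + ∑[ lo < j < p ] (w lo j * W< n j)
        ≡⟨ cong (t lo +_) (sumBetween-cong lo<p (λ j lo<j j<p →
             cong (w lo j *_) (W<-solution n j j<p (longer p≤ lo<j)))) ⟩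
      t lo + ∑[ lo < j < p ] (w lo j * B j)        ≡⟨ sym (B-rec lo lo<p) ⟩
      B lo                                         ∎
      where open ≡-Reasoning

    C<-solution : ∀ n lo → lo ℕ.< p → p ℕ.≤ n ℕ.+ lo → C< n lo ≡ T lo
    C<-solution zero    lo lo<p p≤lo = contradiction p≤lo (ℕ.<⇒≱ lo<p)
    C<-solution (suc n) lo lo<p p≤ = begin
      C< (suc n) lo
        ≡⟨ C<-suc n lo ⟩
      t lo * d lo + ∑[ lo < j < p ] (w lo j * (c lo j * W< n j + C< n j))
        ≡⟨ cong (t lo * d lo +_) (sumBetween-cong lo<p (λ j lo<j j<p →
             cong₂ (λ x y → w lo j * (c lo j * x + y))
                   (W<-solution n j j<p (longer p≤ lo<j)) (C<-solution n j j<p (longer p≤ lo<j)))) ⟩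
      t lo * d lo + ∑[ lo < j < p ] (w lo j * (c lo j * B j + T j))
        ≡⟨ sym (T-rec lo lo<p) ⟩
      T lo
        ∎
      where open ≡-Reasoning

    nonempty-chains-solution :
      ∀ n lo (a : ℕ → ℚ) (F : List ℕ → ℚ) →
      (∀ j r → F (j ∷ r) ≡ w lo j * weight j r * (a j + cost j r)) →
      lo ℕ.< p → p ℕ.≤ suc n ℕ.+ lo →
      ∑[ q < n ] sumℚ (map F (incSeqs (suc q) lo p)) ≡ ∑[ lo < j < p ] (w lo j * (a j * B j + T j))
    nonempty-chains-solution n lo a F F-cons lo<p p≤ = trans (nonempty-chains n lo a F F-cons)
      (sumBetween-cong lo<p (λ j lo<j j<p → cong₂ (λ x y → w lo j * (a j * x + y))
        (W<-solution n j j<p (longer p≤ lo<j)) (C<-solution n j j<p (longer p≤ lo<j))))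

D-factor : ∀ p x → D p x ≡ (p - x) * Q p x
D-factor = solve 2 (λ p x → ᴱ.D p x ⊜ ((p ⊕ ⊝ x) ⊗ ᴱ.Q p x)) refl

Q-shifted : ∀ s x → Q (1ℚ + s) x ≡ s * (s + ι 2) + x * (x + (1ℚ + s))
Q-shifted = solve 2 (λ s x → ᴱ.Q (Κ 1ℚ ⊕ s) x ⊜ (s ⊗ (s ⊕ Κ (ι 2)) ⊕ x ⊗ (x ⊕ (Κ 1ℚ ⊕ s)))) refl

N-shifted : ∀ s → N (1ℚ + s) ≡ (1ℚ + s) * s * s
N-shifted = solve 1 (λ s → ᴱ.N (Κ 1ℚ ⊕ s) ⊜ (Κ 1ℚ ⊕ s) ⊗ s ⊗ s) refl

F₁-step : ∀ p l x → F₁ p l (1ℚ + x) ≡ F₁ p l x + ω l x * β x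
F₁-step = solve 3 (λ p l x → ᴱ.F₁ p l (Κ 1ℚ ⊕ x) ⊜ (ᴱ.F₁ p l x ⊕ ᴱ.ω l x ⊗ ᴱ.β x)) refl

F₂-step : ∀ p l x → F₂ p l (1ℚ + x) ≡ F₂ p l x + ω l x * κ p l x
F₂-step = solve 3 (λ p l x → ᴱ.F₂ p l (Κ 1ℚ ⊕ x) ⊜ (ᴱ.F₂ p l x ⊕ ᴱ.ω l x ⊗ ᴱ.κ p l x)) refl

F₃-step : ∀ p x → F₃ p (1ℚ + x) ≡ F₃ p x + ω 0ℚ x * η p x
F₃-step = solve 2 (λ p x → ᴱ.F₃ p (Κ 1ℚ ⊕ x) ⊜ (ᴱ.F₃ p x ⊕ ᴱ.ω (Κ 0ℚ) x ⊗ ᴱ.η p x)) refl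

B-boundary : ∀ p l → (p - l) * N p + (F₁ p l p - F₁ p l (1ℚ + l)) ≡ D p l * β l
B-boundary = solve 2 (λ p l →
  (p ⊕ ⊝ l) ⊗ ᴱ.N p ⊕ (ᴱ.F₁ p l p ⊕ ⊝ ᴱ.F₁ p l (Κ 1ℚ ⊕ l)) ⊜ ᴱ.D p l ⊗ ᴱ.β l) refl

T-boundary : ∀ p l → (p - l) * edgeCost l p * N p + (F₂ p l p - F₂ p l (1ℚ + l)) ≡ τ p l
T-boundary = solve 2 (λ p l →
  (p ⊕ ⊝ l) ⊗ ᴱ.edgeCost l p ⊗ ᴱ.N p ⊕ (ᴱ.F₂ p l p ⊕ ⊝ ᴱ.F₂ p l (Κ 1ℚ ⊕ l))
  ⊜ ᴱ.τ p l) refl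

total-boundary : ∀ p → F₃ p p - F₃ p (1ℚ + 0ℚ) + τ p 0ℚ ≡ p * (p + 1ℚ) * (p + 1ℚ) * N p
total-boundary = solve 1 (λ p →
  ᴱ.F₃ p p ⊕ ⊝ ᴱ.F₃ p (Κ 1ℚ ⊕ Κ 0ℚ) ⊕ ᴱ.τ p (Κ 0ℚ)
  ⊜ p ⊗ (p ⊕ Κ 1ℚ) ⊗ (p ⊕ Κ 1ℚ) ⊗ ᴱ.N p) refl

vertexCost-certificate : ∀ p x u v → vertexCost p x u v * (D p x * β x)
  ≡ ν p x + frac 5 54 * P p * D p x * (x * u - 1ℚ)
          + frac 1 15 * P p * x * (p + x) * (p - x) * (Q p x * v - 1ℚ)
vertexCost-certificate = solve 4 (λ p x u v →
  ᴱ.vertexCost p x u v ⊗ (ᴱ.D p x ⊗ ᴱ.β x)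
  ⊜ (ᴱ.ν p x ⊕ Κ (frac 5 54) ⊗ ᴱ.P p ⊗ ᴱ.D p x ⊗ (x ⊗ u ⊕ ⊝ Κ 1ℚ)
    ⊕ Κ (frac 1 15) ⊗ ᴱ.P p ⊗ x ⊗ (p ⊕ x) ⊗ (p ⊕ ⊝ x) ⊗ (ᴱ.Q p x ⊗ v ⊕ ⊝ Κ 1ℚ))) refl

headCost-certificate : ∀ p x u → headCost p x u * (D p x * β x)
  ≡ D p x * η p x + (- frac 4 27) * P p * D p x * (x * u - 1ℚ)
headCost-certificate = solve 3 (λ p x u →
  ᴱ.headCost p x u ⊗ (ᴱ.D p x ⊗ ᴱ.β x)
  ⊜ (ᴱ.D p x ⊗ ᴱ.η p x ⊕ Κ (- frac 4 27) ⊗ ᴱ.P p ⊗ ᴱ.D p x ⊗ (x ⊗ u ⊕ ⊝ Κ 1ℚ))) refl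

gFormula-split : ∀ p x u n si ss sφ a →
                 gFormula p x u n si ss sφ a ≡ headCost p x u + additivePart p n si ss sφ a
gFormula-split = solve 8 (λ p x u n si ss sφ a →
  ᴱ.gFormula p x u n si ss sφ a ⊜ (ᴱ.headCost p x u ⊕ ᴱ.additivePart p n si ss sφ a)) refl

additivePart-cons : ∀ p x y u v n si ss sφ a →
  additivePart p (1ℚ + n) (u + si) (x * x + ss) ((p + x) * v + sφ) (x * y + a)
  ≡ vertexCost p x u v + edgeCost x y + additivePart p n si ss sφ a
additivePart-cons = solve 10 (λ p x y u v n si ss sφ a →
  ᴱ.additivePart p (Κ 1ℚ ⊕ n) (u ⊕ si) (x ⊗ x ⊕ ss) ((p ⊕ x) ⊗ v ⊕ sφ) (x ⊗ y ⊕ a)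
  ⊜ (ᴱ.vertexCost p x u v ⊕ ᴱ.edgeCost x y ⊕ ᴱ.additivePart p n si ss sφ a)) refl

additivePart-nil : ∀ p → additivePart p 0ℚ 0ℚ 0ℚ 0ℚ 0ℚ ≡ 0ℚ
additivePart-nil = solve 1 (λ p → ᴱ.additivePart p (Κ 0ℚ) (Κ 0ℚ) (Κ 0ℚ) (Κ 0ℚ) (Κ 0ℚ) ⊜ Κ 0ℚ) refl

edgeCost-origin : ∀ x → edgeCost 0ℚ x ≡ 0ℚ
edgeCost-origin = solve 1 (λ x → ᴱ.edgeCost (Κ 0ℚ) x ⊜ Κ 0ℚ) refl

Q-nonzero : ∀ {p} j → 2 ℕ.≤ p → Q (ι p) (ι j) ≢ 0ℚ
Q-nonzero {suc s} j (s≤s (s≤s _)) = ι-nonzero n (s≤s z≤n) ∘ trans (sym Q≡ι)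
  where
  open ≡-Reasoning
  n : ℕ
  n = s ℕ.* (s ℕ.+ 2) ℕ.+ j ℕ.* (j ℕ.+ suc s)
  Q≡ι : Q (ι (suc s)) (ι j) ≡ ι n
  Q≡ι = begin
    Q (ι (suc s)) (ι j)                            ≡⟨ cong (λ z → Q z (ι j)) (ι-suc s) ⟩
    Q (1ℚ + ι s) (ι j)                             ≡⟨ Q-shifted (ι s) (ι j) ⟩
    ι s * (ι s + ι 2) + ι j * (ι j + (1ℚ + ι s))
      ≡⟨ sym (cong₂ (λ a b → ι s * a + ι j * (ι j + b)) (ι-+ s 2) (ι-suc s)) ⟩
    ι s * ι (s ℕ.+ 2) + ι j * (ι j + ι (suc s))
      ≡⟨ sym (cong₂ _+_ (ι-* s (s ℕ.+ 2)) (trans (ι-* j (j ℕ.+ suc s)) (cong (ι j *_) (ι-+ j (suc s))))) ⟩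
    ι (s ℕ.* (s ℕ.+ 2)) + ι (j ℕ.* (j ℕ.+ suc s))
      ≡⟨ sym (ι-+ (s ℕ.* (s ℕ.+ 2)) (j ℕ.* (j ℕ.+ suc s))) ⟩
    ι n
      ∎

N-nonzero : ∀ {p} → 2 ℕ.≤ p → N (ι p) ≢ 0ℚ
N-nonzero {suc s} (s≤s (s≤s _)) = ι-nonzero (suc s ℕ.* s ℕ.* s) (s≤s z≤n) ∘ trans (sym N≡ι)
  where
  open ≡-Reasoning
  N≡ι : N (ι (suc s)) ≡ ι (suc s ℕ.* s ℕ.* s)
  N≡ι = begin
    N (ι (suc s))               ≡⟨ cong N (ι-suc s) ⟩
    N (1ℚ + ι s)                ≡⟨ N-shifted (ι s) ⟩
    (1ℚ + ι s) * ι s * ι s      ≡⟨ cong (λ z → z * ι s * ι s) (sym (ι-suc s)) ⟩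
    ι (suc s) * ι s * ι s       ≡⟨ sym (trans (ι-* (suc s ℕ.* s) s) (cong (_* ι s) (ι-* (suc s) s))) ⟩
    ι (suc s ℕ.* s ℕ.* s)       ∎

D-nonzero : ∀ {p j} → 2 ℕ.≤ p → j ℕ.< p → D (ι p) (ι j) ≢ 0ℚ
D-nonzero {p} {j} p≥2 j<p = *-≢0 gap≢0 (Q-nonzero j p≥2) ∘ trans (sym (D-factor (ι p) (ι j)))
  where
  gap≢0 : ι p - ι j ≢ 0ℚ
  gap≢0 = ι-nonzero (p ℕ.∸ j) (ℕ.m<n⇒0<n∸m j<p) ∘ trans (ι-∸ (ℕ.<⇒≤ j<p))

module Fixed-p (p : ℕ) (p≥2 : 2 ℕ.≤ p) where

  Dₚ Qₚ : ℕ → ℚ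
  Dₚ j = D (ι p) (ι j)
  Qₚ j = Q (ι p) (ι j)

  e : ℕ → ℕ → ℚ
  e lo j = ω (ι lo) (ι j) * inv (Dₚ j)

  t : ℕ → ℚ
  t lo = ι p - ι lo

  vertex : ℕ → ℚ
  vertex j = vertexCost (ι p) (ι j) (inv (ι j)) (inv (Qₚ j))

  c : ℕ → ℕ → ℚ
  c lo j = edgeCost (ι lo) (ι j) + vertex j

  d : ℕ → ℚ
  d lo = edgeCost (ι lo) (ι p)

  head : ℕ → ℚ
  head j = headCost (ι p) (ι j) (inv (ι j))

  open Chains p e t c d

  γ : ℚ
  γ = inv (N (ι p))

  B T : ℕ → ℚ
  B j = γ * (Dₚ j * β (ι j))
  T j = γ * τ (ι p) (ι j)

  0<p : 0 ℕ.< p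
  0<p = ℕ.≤-trans (s≤s z≤n) p≥2

  γ-cancel : ∀ a → γ * (a * N (ι p)) ≡ a
  γ-cancel a = begin
    γ * (a * N (ι p))   ≡⟨ identity γ a (N (ι p)) ⟩
    a * (γ * N (ι p))   ≡⟨ cong (a *_) (inv-cancelˡ (N-nonzero p≥2)) ⟩
    a * 1ℚ              ≡⟨ *-identityʳ a ⟩
    a                   ∎
    where
    open ≡-Reasoning
    identity : ∀ g a n → g * (a * n) ≡ a * (g * n)
    identity = solve-∀ ℚ-ring

  γ-expand : ∀ a Δ → γ * (a * N (ι p) + Δ) ≡ a + γ * Δ
  γ-expand a Δ = trans (*-distribˡ-+ γ (a * N (ι p)) Δ) (cong (_+ γ * Δ) (γ-cancel a))

  edge-closed : ∀ lo j s → j ℕ.< p → e lo j * (γ * (Dₚ j * s)) ≡ γ * (ω (ι lo) (ι j) * s)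
  edge-closed lo j s j<p = begin
    ω (ι lo) (ι j) * inv (Dₚ j) * (γ * (Dₚ j * s))
      ≡⟨ identity (ω (ι lo) (ι j)) (inv (Dₚ j)) γ (Dₚ j) s ⟩
    γ * (ω (ι lo) (ι j) * s) * (inv (Dₚ j) * Dₚ j)
      ≡⟨ cong (γ * (ω (ι lo) (ι j) * s) *_) (inv-cancelˡ (D-nonzero p≥2 j<p)) ⟩
    γ * (ω (ι lo) (ι j) * s) * 1ℚ
      ≡⟨ *-identityʳ (γ * (ω (ι lo) (ι j) * s)) ⟩
    γ * (ω (ι lo) (ι j) * s)
      ∎
    where
    open ≡-Reasoning
    identity : ∀ w i g D s → w * i * (g * (D * s)) ≡ g * (w * s) * (i * D)
    identity = solve-∀ ℚ-ring

  sum-closed : ∀ {lo} {s : ℕ → ℚ} (F f : ℚ → ℚ) → lo ℕ.< p →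
               (∀ j → lo ℕ.< j → j ℕ.< p → s j ≡ γ * f (ι j)) → (∀ x → F (1ℚ + x) ≡ F x + f x) →
               ∑[ lo < j < p ] s j ≡ γ * (F (ι p) - F (1ℚ + ι lo))
  sum-closed {lo} {s} F f lo<p s≡γf step = begin
    ∑[ lo < j < p ] s j               ≡⟨ sumBetween-cong lo<p s≡γf ⟩
    ∑[ lo < j < p ] (γ * f (ι j))     ≡⟨ sumFrom-*ˡ (suc lo) (p ℕ.∸ suc lo) γ (f ∘ ι) ⟩
    γ * ∑[ lo < j < p ] f (ι j)       ≡⟨ cong (γ *_) (sumBetween-telescope {F} {f} step lo<p) ⟩
    γ * (F (ι p) - F (1ℚ + ι lo))     ∎
    where open ≡-Reasoning

  B-rec : ∀ lo → lo ℕ.< p → B lo ≡ t lo + ∑[ lo < j < p ] (e lo j * B j)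
  B-rec lo lo<p = begin
      B lo
    ≡⟨ cong (γ *_) (sym (B-boundary (ι p) (ι lo))) ⟩
      γ * (t lo * N (ι p) + ΔF₁)
    ≡⟨ γ-expand (t lo) ΔF₁ ⟩
      t lo + γ * ΔF₁
    ≡⟨ cong (t lo +_) (sym (sum-closed (F₁ (ι p) (ι lo)) (λ x → ω (ι lo) x * β x) lo<p
                                       (λ j _ j<p → edge-closed lo j (β (ι j)) j<p)
                                       (F₁-step (ι p) (ι lo)))) ⟩
      t lo + ∑[ lo < j < p ] (e lo j * B j)
    ∎
    where
    open ≡-Reasoning
    ΔF₁ : ℚ
    ΔF₁ = F₁ (ι p) (ι lo) (ι p) - F₁ (ι p) (ι lo) (1ℚ + ι lo)

  vertex-B : ∀ j → 0 ℕ.< j → vertex j * (Dₚ j * β (ι j)) ≡ ν (ι p) (ι j)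
  vertex-B j 0<j = begin
    vertex j * (Dₚ j * β (ι j))
      ≡⟨ vertexCost-certificate (ι p) (ι j) (inv (ι j)) (inv (Qₚ j)) ⟩
    ν (ι p) (ι j) + b₁ * (ι j * inv (ι j) - 1ℚ) + b₂ * (Qₚ j * inv (Qₚ j) - 1ℚ)
      ≡⟨ drop-unit (ν (ι p) (ι j) + b₁ * (ι j * inv (ι j) - 1ℚ)) b₂ (inv-cancelʳ (Q-nonzero j p≥2)) ⟩
    ν (ι p) (ι j) + b₁ * (ι j * inv (ι j) - 1ℚ)
      ≡⟨ drop-unit (ν (ι p) (ι j)) b₁ (inv-cancelʳ (ι-nonzero j 0<j)) ⟩
    ν (ι p) (ι j)
      ∎
    where
    open ≡-Reasoning
    b₁ b₂ : ℚ
    b₁ = frac 5 54 * P (ι p) * Dₚ j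
    b₂ = frac 1 15 * P (ι p) * ι j * (ι p + ι j) * (ι p - ι j)

  cost-closed : ∀ lo j → 0 ℕ.< j → c lo j * B j + T j ≡ γ * (Dₚ j * κ (ι p) (ι lo) (ι j))
  cost-closed lo j 0<j = begin
    (edgeCost (ι lo) (ι j) + vertex j) * (γ * (Dₚ j * β (ι j))) + γ * (Dₚ j * σ (ι p) (ι j) - ν (ι p) (ι j))
      ≡⟨ identity (edgeCost (ι lo) (ι j)) (vertex j) γ (Dₚ j) (β (ι j)) (σ (ι p) (ι j)) (ν (ι p) (ι j)) ⟩
    γ * (Dₚ j * κ (ι p) (ι lo) (ι j)) + γ * (vertex j * (Dₚ j * β (ι j)) - ν (ι p) (ι j))
      ≡⟨ cong (λ z → γ * (Dₚ j * κ (ι p) (ι lo) (ι j)) + γ * (z - ν (ι p) (ι j))) (vertex-B j 0<j) ⟩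
    γ * (Dₚ j * κ (ι p) (ι lo) (ι j)) + γ * (ν (ι p) (ι j) - ν (ι p) (ι j))
      ≡⟨ cancel (γ * (Dₚ j * κ (ι p) (ι lo) (ι j))) γ (ν (ι p) (ι j)) ⟩
    γ * (Dₚ j * κ (ι p) (ι lo) (ι j))
      ∎
    where
    open ≡-Reasoning
    identity : ∀ b v g D r s n →
               (b + v) * (g * (D * r)) + g * (D * s - n) ≡ g * (D * (b * r + s)) + g * (v * (D * r) - n)
    identity = solve-∀ ℚ-ring
    cancel : ∀ x g n → x + g * (n - n) ≡ x
    cancel = solve-∀ ℚ-ring

  T-rec : ∀ lo → lo ℕ.< p → T lo ≡ t lo * d lo + ∑[ lo < j < p ] (e lo j * (c lo j * B j + T j))
  T-rec lo lo<p = begin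
      T lo
    ≡⟨ cong (γ *_) (sym (T-boundary (ι p) (ι lo))) ⟩
      γ * (t lo * d lo * N (ι p) + ΔF₂)
    ≡⟨ γ-expand (t lo * d lo) ΔF₂ ⟩
      t lo * d lo + γ * ΔF₂
    ≡⟨ cong (t lo * d lo +_) (sym (sum-closed (F₂ (ι p) (ι lo)) (λ x → ω (ι lo) x * κ (ι p) (ι lo) x)
                                              lo<p summand (F₂-step (ι p) (ι lo)))) ⟩
      t lo * d lo + ∑[ lo < j < p ] (e lo j * (c lo j * B j + T j))
    ∎
    where
    open ≡-Reasoning
    ΔF₂ : ℚ
    ΔF₂ = F₂ (ι p) (ι lo) (ι p) - F₂ (ι p) (ι lo) (1ℚ + ι lo)
    summand : ∀ j → lo ℕ.< j → j ℕ.< p →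
              e lo j * (c lo j * B j + T j) ≡ γ * (ω (ι lo) (ι j) * κ (ι p) (ι lo) (ι j))
    summand j lo<j j<p = trans (cong (e lo j *_) (cost-closed lo j (ℕ.≤-trans (s≤s z≤n) lo<j)))
                               (edge-closed lo j (κ (ι p) (ι lo) (ι j)) j<p)

  head-B : ∀ j → 0 ℕ.< j → head j * B j ≡ γ * (Dₚ j * η (ι p) (ι j))
  head-B j 0<j = trans (identity (head j) γ (Dₚ j * β (ι j)))
    (cong (γ *_) (trans (headCost-certificate (ι p) (ι j) (inv (ι j)))
                        (drop-unit (Dₚ j * η (ι p) (ι j)) ((- frac 4 27) * P (ι p) * Dₚ j)
                                   (inv-cancelʳ (ι-nonzero j 0<j)))))
    where
    identity : ∀ h g x → h * (g * x) ≡ g * (h * x)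
    identity = solve-∀ ℚ-ring

  head-sum : ∑[ 0 < j < p ] (e 0 j * (head j * B j)) ≡ γ * (F₃ (ι p) (ι p) - F₃ (ι p) (1ℚ + ι 0))
  head-sum = sum-closed (F₃ (ι p)) (λ x → ω 0ℚ x * η (ι p) x) 0<p
    (λ j 0<j j<p → trans (cong (e 0 j *_) (head-B j 0<j)) (edge-closed 0 j (η (ι p) (ι j)) j<p)) (F₃-step (ι p))

  T-origin : ∑[ 0 < j < p ] (e 0 j * (c 0 j * B j + T j)) ≡ T 0
  T-origin =
    sym (trans (T-rec 0 0<p) (trans (cong (λ z → t 0 * z + S) (edgeCost-origin (ι p))) (identity (t 0) S)))
    where
    S : ℚ
    S = ∑[ 0 < j < p ] (e 0 j * (c 0 j * B j + T j))
    identity : ∀ a s → a * 0ℚ + s ≡ s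
    identity = solve-∀ ℚ-ring

  nq-weight : ∀ prev js →
              powℚ (- ι 12) (length js) * prodℚ (map ι js) * gaps p prev js * inv (prodℚ (map Dₚ js))
              ≡ weight prev js
  nq-weight prev []       = identity (ι p - ι prev)
    where
    identity : ∀ x → 1ℚ * 1ℚ * x * 1ℚ ≡ x
    identity = solve-∀ ℚ-ring
  nq-weight prev (j ∷ js) = begin
    - ι 12 * X * (ι j * Y) * ((ι j - ι prev) * G) * inv (Dₚ j * Z)
      ≡⟨ cong (- ι 12 * X * (ι j * Y) * ((ι j - ι prev) * G) *_) (inv-* (Dₚ j) Z) ⟩
    - ι 12 * X * (ι j * Y) * ((ι j - ι prev) * G) * (inv (Dₚ j) * inv Z)
      ≡⟨ identity X (ι j) Y (ι prev) G (inv (Dₚ j)) (inv Z) ⟩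
    e prev j * (X * Y * G * inv Z)
      ≡⟨ cong (e prev j *_) (nq-weight j js) ⟩
    e prev j * weight j js
      ∎
    where
    open ≡-Reasoning
    X Y G Z : ℚ
    X = powℚ (- ι 12) (length js)
    Y = prodℚ (map ι js)
    G = gaps p j js
    Z = prodℚ (map Dₚ js)
    identity : ∀ X x Y l G d Z →
               - ι 12 * X * (x * Y) * ((x - l) * G) * (d * Z) ≡ ι 12 * x * (l - x) * d * (X * Y * G * Z)
    identity = solve-∀ ℚ-ring

  next : List ℕ → ℕ
  next []      = p
  next (k ∷ _) = k

  adj-cons : ∀ j js → adj p (j ∷ js) ≡ ι j * ι (next js) + adj p js
  adj-cons j []      = sym (+-identityʳ (ι j * ι p))
  adj-cons j (k ∷ _) = refl

  Σinv Σsq Σφ gAdditive : List ℕ → ℚ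
  Σinv js = sumℚ (map (λ j → inv (ι j)) js)
  Σsq  js = sumℚ (map (λ j → ι j * ι j) js)
  Σφ   js = sumℚ (map (λ j → (ι p + ι j) * inv (Qₚ j)) js)
  gAdditive js = additivePart (ι p) (ι (length js)) (Σinv js) (Σsq js) (Σφ js) (adj p js)

  gAdditive-cons : ∀ j js → gAdditive (j ∷ js) ≡ vertex j + edgeCost (ι j) (ι (next js)) + gAdditive js
  gAdditive-cons j js =
    trans (cong₂ (λ n a → additivePart (ι p) n (Σinv (j ∷ js)) (Σsq (j ∷ js)) (Σφ (j ∷ js)) a)
                 (ι-suc (length js)) (adj-cons j js))
          (additivePart-cons (ι p) (ι j) (ι (next js)) (inv (ι j)) (inv (Qₚ j))
                             (ι (length js)) (Σinv js) (Σsq js) (Σφ js) (adj p js))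

  cost-gAdditive : ∀ lo js → cost lo js ≡ edgeCost (ι lo) (ι (next js)) + gAdditive js
  cost-gAdditive lo []       =
    sym (trans (cong (edgeCost (ι lo) (ι p) +_) (additivePart-nil (ι p))) (+-identityʳ (edgeCost (ι lo) (ι p))))
  cost-gAdditive lo (j ∷ js) = begin
    edgeCost (ι lo) (ι j) + vertex j + cost j js
      ≡⟨ cong (edgeCost (ι lo) (ι j) + vertex j +_) (cost-gAdditive j js) ⟩
    edgeCost (ι lo) (ι j) + vertex j + (edgeCost (ι j) (ι (next js)) + gAdditive js)
      ≡⟨ identity (edgeCost (ι lo) (ι j)) (vertex j) (edgeCost (ι j) (ι (next js))) (gAdditive js) ⟩
    edgeCost (ι lo) (ι j) + (vertex j + edgeCost (ι j) (ι (next js)) + gAdditive js)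
      ≡⟨ cong (edgeCost (ι lo) (ι j) +_) (sym (gAdditive-cons j js)) ⟩
    edgeCost (ι lo) (ι j) + gAdditive (j ∷ js)
      ∎
    where
    open ≡-Reasoning
    identity : ∀ a b c d → a + b + (c + d) ≡ a + (b + c + d)
    identity = solve-∀ ℚ-ring

  gq-cost : ∀ j r → gq p (j ∷ r) ≡ head j + cost 0 (j ∷ r)
  gq-cost j r = begin
    gq p (j ∷ r)
      ≡⟨ gFormula-split (ι p) (ι j) (inv (ι j)) (ι (length (j ∷ r)))
                        (Σinv (j ∷ r)) (Σsq (j ∷ r)) (Σφ (j ∷ r)) (adj p (j ∷ r)) ⟩
    head j + gAdditive (j ∷ r)
      ≡⟨ cong (head j +_) (sym (trans (cost-gAdditive 0 (j ∷ r))
                                      (trans (cong (_+ gAdditive (j ∷ r)) (edgeCost-origin (ι j)))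
                                             (+-identityˡ (gAdditive (j ∷ r)))))) ⟩
    head j + cost 0 (j ∷ r)
      ∎
    where open ≡-Reasoning

  totalSum-chains : totalSum p ≡ ∑[ 0 < j < p ] (e 0 j * ((head j + c 0 j) * B j + T j))
  totalSum-chains = begin
    totalSum p                      ≡⟨ sum-between X 1 p ⟩
    sumFrom 1 (p ℕ.∸ 1) X           ≡⟨ sumFrom-suc 0 (p ℕ.∸ 1) X ⟩
    ∑[ q < p ℕ.∸ 1 ] X (suc q)      ≡⟨ nonempty-chains-solution B T B-rec T-rec (p ℕ.∸ 1) 0
                                         (λ j → head j + c 0 j) (λ js → nq p js * gq p js)
                                         first-vertex 0<p long-enough ⟩
    ∑[ 0 < j < p ] (e 0 j * ((head j + c 0 j) * B j + T j))  ∎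
    where
    open ≡-Reasoning
    X : ℕ → ℚ
    X q = sumℚ (map (λ js → nq p js * gq p js) (incSeqs q 0 p))
    first-vertex : ∀ j r → nq p (j ∷ r) * gq p (j ∷ r) ≡ e 0 j * weight j r * (head j + c 0 j + cost j r)
    first-vertex j r =
      cong₂ _*_ (nq-weight 0 (j ∷ r)) (trans (gq-cost j r) (sym (+-assoc (head j) (c 0 j) (cost j r))))
    long-enough : p ℕ.≤ suc (p ℕ.∸ 1) ℕ.+ 0
    long-enough = ℕ.≤-reflexive (sym (trans (ℕ.+-identityʳ _) (ℕ.m+[n∸m]≡n 0<p)))

  split-head : ∑[ 0 < j < p ] (e 0 j * ((head j + c 0 j) * B j + T j))
               ≡ ∑[ 0 < j < p ] (e 0 j * (head j * B j)) + ∑[ 0 < j < p ] (e 0 j * (c 0 j * B j + T j))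
  split-head = trans (sumBetween-cong-≗ 0 p (λ j → identity (e 0 j) (head j) (c 0 j) (B j) (T j)))
                     (sumFrom-+ 1 (p ℕ.∸ 1) (λ j → e 0 j * (head j * B j)) (λ j → e 0 j * (c 0 j * B j + T j)))
    where
    identity : ∀ w h c b t → w * ((h + c) * b + t) ≡ w * (h * b) + w * (c * b + t)
    identity = solve-∀ ℚ-ring

mainTheorem3 : (p : ℕ) → 2 ℕ.≤ p → totalSum p ≡ ι (p ℕ.* (p ℕ.+ 1) ℕ.* (p ℕ.+ 1))
mainTheorem3 p p≥2 = begin
    totalSum p
  ≡⟨ totalSum-chains ⟩
    ∑[ 0 < j < p ] (e 0 j * ((head j + c 0 j) * B j + T j))
  ≡⟨ split-head ⟩
    ∑[ 0 < j < p ] (e 0 j * (head j * B j)) + ∑[ 0 < j < p ] (e 0 j * (c 0 j * B j + T j))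
  ≡⟨ cong₂ _+_ head-sum T-origin ⟩
    γ * (F₃ (ι p) (ι p) - F₃ (ι p) (1ℚ + ι 0)) + γ * τ (ι p) (ι 0)
  ≡⟨ sym (*-distribˡ-+ γ _ _) ⟩
    γ * (F₃ (ι p) (ι p) - F₃ (ι p) (1ℚ + ι 0) + τ (ι p) (ι 0))
  ≡⟨ cong (γ *_) (total-boundary (ι p)) ⟩
    γ * (ι p * (ι p + 1ℚ) * (ι p + 1ℚ) * N (ι p))
  ≡⟨ γ-cancel (ι p * (ι p + 1ℚ) * (ι p + 1ℚ)) ⟩
    ι p * (ι p + 1ℚ) * (ι p + 1ℚ)
  ≡⟨ sym (ι-p[p+1]² p) ⟩
    ι (p ℕ.* (p ℕ.+ 1) ℕ.* (p ℕ.+ 1))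
  ∎
  where
  open Fixed-p p p≥2
  open ≡-Reasoning
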